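{- Assume the configuration in the context. Let $\mathfrak{a}$ be a line in $\pi_{12}$ through $P_{12}$, not equal to $\langle M_1,P_{12}\rangle$ or $\langle M_2,P_{12}\rangle$. Then $\{a_3^{(A)} : A\in\mathfrak{a}\setminus\{P_{12}\}\}$ is a set of $q$ lines lying in a plane of $\Sigma_3$ through $s$ and all going through a fixed point of $\beta$.
   Context: Work in $\mathrm{PG}(4,q)$, $q$ a prime power; $\langle\cdot\rangle$ denotes span. Let $\Sigma_1,\Sigma_2,\Sigma_3$ be solids (3-subspaces) such that $m:=\Sigma_1\cap\Sigma_2\cap\Sigma_3$ is a line, and let $M_1,M_2$ be two distinct points on $m$. For $1\leq i<j\leq3$ let $\pi_{ij}:=\Sigma_i\cap\Sigma_j$ (a plane) and let $P_{ij}\in\pi_{ij}\setminus m$ be a point. For each $i\in\{1,2\}$, let $\ell_{i2}:=\langle P_{12},P_{i3}\rangle$ and let $\ell_{i1}$ be a line in $\Sigma_i$ through $M_i$ that does not intersect $\ell_{i2}$ and is not contained in $\pi_{12}$ or $\pi_{i3}$. Let $s:=\langle P_{13},P_{23}\rangle$ and $\beta:=\langle\ell_{11},\ell_{21}\rangle\cap\Sigma_3$ (a plane). Let $\Pi^{(4)}$ be the set of all planes meeting each of $\ell_{11},\ell_{12},\ell_{21},\ell_{22}$. For every point $A\in\pi_{12}\setminus(\langle M_1,P_{12}\rangle\cup\langle M_2,P_{12}\rangle)$ there is a unique plane $\alpha^{(A)}\in\Pi^{(4)}$ meeting $\pi_{12}$ in precisely the point $A$; define the line $a_3^{(A)}:=\alpha^{(A)}\cap\Sigma_3$.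 -}

module Defs where

open import Level using (Level; _⊔_)
open import Data.Nat using (ℕ)
open import Data.Fin using (Fin; zero; suc)
open import Data.Product using (Σ; _×_; _,_)
open import Data.Vec.Functional using ([]; _∷_)
open import Relation.Nullary using (¬_)
open import Relation.Binary.PropositionalEquality using (_≡_)
open import Algebra.Bundles using (CommutativeRing)

record IsFieldOn {c ℓ : Level} (R : CommutativeRing c ℓ) : Set (c ⊔ ℓ) where
  open CommutativeRing R using (Carrier; _≈_; _+_; _*_; 0#; 1#)
  field
    0≉1     : ¬ (0# ≈ 1#)
    inverse : ∀ x → ¬ (x ≈ 0#) → Σ Carrier λ y → x * y ≈ 1#

record IsFiniteFieldOfOrder {c ℓ : Level} (R : CommutativeRing c ℓ) (q : ℕ)
       : Set (c ⊔ ℓ) where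
  open CommutativeRing R using (Carrier; _≈_; _+_; _*_; 0#; 1#)
  field
    isField    : IsFieldOn R
    enum       : Fin q → Carrier
    enum-surj  : ∀ x → Σ (Fin q) λ i → enum i ≈ x
    enum-inj   : ∀ i j → enum i ≈ enum j → i ≡ j

-- PG(4,F) modelled on the vector space F^5.  A point is a nonzero vector
-- (up to proportionality); a projective subspace is the span of a family
-- of vectors; an (n-1)-dimensional projective subspace is the span of n
-- linearly independent vectors.

module PG4 {c ℓ : Level} (R : CommutativeRing c ℓ) where
  open CommutativeRing R using (Carrier; _≈_; _+_; _*_; 0#; 1#)

  V : Set c
  V = Fin 5 → Carrier

  _≈ᵥ_ : V → V → Set ℓ
  u ≈ᵥ v = ∀ i → u i ≈ v i

  0ᵥ : V
  0ᵥ _ = 0#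

  _+ᵥ_ : V → V → V
  (u +ᵥ v) i = u i + v i

  _•_ : Carrier → V → V
  (a • v) i = a * v i

  NonZero : V → Set ℓ
  NonZero v = ¬ (v ≈ᵥ 0ᵥ)

  lincomb : ∀ {k} → (Fin k → Carrier) → (Fin k → V) → V
  lincomb {ℕ.zero}  cs g = 0ᵥ
  lincomb {ℕ.suc k} cs g = (cs zero • g zero) +ᵥ lincomb (λ i → cs (suc i)) (λ i → g (suc i))

  Independent : ∀ {k} → (Fin k → V) → Set (c ⊔ ℓ)
  Independent g = ∀ cs → lincomb cs g ≈ᵥ 0ᵥ → ∀ i → cs i ≈ 0#

  PSet : Set (Level.suc (c ⊔ ℓ))
  PSet = V → Set (c ⊔ ℓ)

  ⟦_⟧ : ∀ {k} → (Fin k → V) → PSet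
  ⟦ g ⟧ v = Σ (_ → Carrier) λ cs → v ≈ᵥ lincomb cs g

  _∩_ : PSet → PSet → PSet
  (S ∩ T) v = S v × T v

  _⊆_ : PSet → PSet → Set (c ⊔ ℓ)
  S ⊆ T = ∀ v → S v → T v

  _≐_ : PSet → PSet → Set (c ⊔ ℓ)
  S ≐ T = (S ⊆ T) × (T ⊆ S)

  Meets : PSet → PSet → Set (c ⊔ ℓ)
  Meets S T = Σ V λ v → NonZero v × S v × T v

  SamePoint : V → V → Set (c ⊔ ℓ)
  SamePoint u v = Σ Carrier λ a → u ≈ᵥ (a • v)

  IsLine : PSet → Set (c ⊔ ℓ)
  IsLine S = Σ V λ u → Σ V λ w → Independent (u ∷ w ∷ []) × (S ≐ ⟦ u ∷ w ∷ [] ⟧)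

  MeetsPreciselyIn : (Fin 3 → V) → PSet → V → Set (c ⊔ ℓ)
  MeetsPreciselyIn α T A =
    ⟦ α ⟧ A × T A × (∀ v → NonZero v → ⟦ α ⟧ v → T v → SamePoint v A)

  record Configuration : Set (c ⊔ ℓ) where
    field
      Σ₁ Σ₂ Σ₃ : Fin 4 → V
      Σ₁-ind : Independent Σ₁
      Σ₂-ind : Independent Σ₂
      Σ₃-ind : Independent Σ₃
      m : Fin 2 → V
      m-ind : Independent m
      m-def : ⟦ m ⟧ ≐ (⟦ Σ₁ ⟧ ∩ (⟦ Σ₂ ⟧ ∩ ⟦ Σ₃ ⟧))
      M₁ M₂ : V
      M₁-nz : NonZero M₁
      M₂-nz : NonZero M₂
      M₁∈m : ⟦ m ⟧ M₁
      M₂∈m : ⟦ m ⟧ M₂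
      M₁≠M₂ : ¬ SamePoint M₁ M₂
      π₁₂ π₁₃ π₂₃ : Fin 3 → V
      π₁₂-ind : Independent π₁₂
      π₁₃-ind : Independent π₁₃
      π₂₃-ind : Independent π₂₃
      π₁₂-def : ⟦ π₁₂ ⟧ ≐ (⟦ Σ₁ ⟧ ∩ ⟦ Σ₂ ⟧)
      π₁₃-def : ⟦ π₁₃ ⟧ ≐ (⟦ Σ₁ ⟧ ∩ ⟦ Σ₃ ⟧)
      π₂₃-def : ⟦ π₂₃ ⟧ ≐ (⟦ Σ₂ ⟧ ∩ ⟦ Σ₃ ⟧)
      P₁₂ P₁₃ P₂₃ : V
      P₁₂-nz : NonZero P₁₂
      P₁₃-nz : NonZero P₁₃
      P₂₃-nz : NonZero P₂₃
      P₁₂∈π₁₂ : ⟦ π₁₂ ⟧ P₁₂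
      P₁₃∈π₁₃ : ⟦ π₁₃ ⟧ P₁₃
      P₂₃∈π₂₃ : ⟦ π₂₃ ⟧ P₂₃
      P₁₂∉m : ¬ ⟦ m ⟧ P₁₂
      P₁₃∉m : ¬ ⟦ m ⟧ P₁₃
      P₂₃∉m : ¬ ⟦ m ⟧ P₂₃
      N₁ N₂ : V
      ℓ₁₁-ind : Independent (M₁ ∷ N₁ ∷ [])
      ℓ₂₁-ind : Independent (M₂ ∷ N₂ ∷ [])
      N₁∈Σ₁ : ⟦ Σ₁ ⟧ N₁
      N₂∈Σ₂ : ⟦ Σ₂ ⟧ N₂
      ℓ₁₁∩ℓ₁₂ : ¬ Meets ⟦ M₁ ∷ N₁ ∷ [] ⟧ ⟦ P₁₂ ∷ P₁₃ ∷ [] ⟧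
      ℓ₂₁∩ℓ₂₂ : ¬ Meets ⟦ M₂ ∷ N₂ ∷ [] ⟧ ⟦ P₁₂ ∷ P₂₃ ∷ [] ⟧
      ℓ₁₁⊈π₁₂ : ¬ (⟦ M₁ ∷ N₁ ∷ [] ⟧ ⊆ ⟦ π₁₂ ⟧)
      ℓ₁₁⊈π₁₃ : ¬ (⟦ M₁ ∷ N₁ ∷ [] ⟧ ⊆ ⟦ π₁₃ ⟧)
      ℓ₂₁⊈π₁₂ : ¬ (⟦ M₂ ∷ N₂ ∷ [] ⟧ ⊆ ⟦ π₁₂ ⟧)
      ℓ₂₁⊈π₂₃ : ¬ (⟦ M₂ ∷ N₂ ∷ [] ⟧ ⊆ ⟦ π₂₃ ⟧)

    ℓ₁₁ ℓ₁₂ ℓ₂₁ ℓ₂₂ s : Fin 2 → V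
    ℓ₁₁ = M₁ ∷ N₁ ∷ []
    ℓ₁₂ = P₁₂ ∷ P₁₃ ∷ []
    ℓ₂₁ = M₂ ∷ N₂ ∷ []
    ℓ₂₂ = P₁₂ ∷ P₂₃ ∷ []
    s   = P₁₃ ∷ P₂₃ ∷ []

    β : PSet
    β = ⟦ M₁ ∷ N₁ ∷ M₂ ∷ N₂ ∷ [] ⟧ ∩ ⟦ Σ₃ ⟧

    InΠ⁴ : (Fin 3 → V) → Set (c ⊔ ℓ)
    InΠ⁴ α = Independent α
           × Meets ⟦ α ⟧ ⟦ ℓ₁₁ ⟧ × Meets ⟦ α ⟧ ⟦ ℓ₁₂ ⟧
           × Meets ⟦ α ⟧ ⟦ ℓ₂₁ ⟧ × Meets ⟦ α ⟧ ⟦ ℓ₂₂ ⟧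

    IsαOf : V → (Fin 3 → V) → Set (c ⊔ ℓ)
    IsαOf A α = InΠ⁴ α × MeetsPreciselyIn α ⟦ π₁₂ ⟧ A

    a₃ : (Fin 3 → V) → PSet
    a₃ α = ⟦ α ⟧ ∩ ⟦ Σ₃ ⟧

-- For i = 1, 2 (with j the other index) let σᵢ = ⟨Pᵢ₃, 𝔞⟩, a plane of Σᵢ. It misses Mᵢ: otherwise Mᵢ ∈ σᵢ ∩ Σⱼ = 𝔞
-- and 𝔞 = ⟨Mᵢ, P₁₂⟩. So ℓᵢ₁ meets σᵢ in a single point Eᵢ. Every α = α^(A) with A ∈ 𝔞 ∖ {P₁₂} contains Eᵢ: if
-- C = α ∩ ℓᵢ₁ and B = α ∩ ℓᵢ₂, then B ∉ Σⱼ (else B would be the point α ∩ π₁₂ = A, but B ∈ ℓᵢ₂ ∩ Σⱼ = P₁₂), so the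
-- line BC meets Σⱼ in a point of α ∩ π₁₂, that is in A; as ℓᵢ₁ and ℓᵢ₂ are skew, C ∈ ⟨A, B⟩ ⊆ σᵢ and C = Eᵢ.
-- Hence α = ⟨E₂, E₁, A⟩, and a₃^(A) is the line through X = ⟨E₂, E₁⟩ ∩ Σ₃ ∈ β and D = ⟨E₁, A⟩ ∩ Σ₃. All these planes
-- lie in the solid ⟨P₂₃, P₁₃, 𝔞⟩, which meets Σ₃ in the plane τ = ⟨P₂₃, P₁₃, Q⟩ ⊇ s with Q = 𝔞 ∩ m. Finally, if
-- a₃^(A) = a₃^(A′) then D ∈ ⟨E₂, E₁, A′⟩ ∩ Σ₁ = ⟨E₁, A′⟩, so A ∈ ⟨E₁, A′⟩ ∩ Σ₂ = A′. The order q of the field is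
-- used only to make its equality decidable.

module Submission where

open import Defs
open import Level using (Level)
open import Data.Nat using (ℕ)
open import Data.Fin using (Fin)
open import Data.Product using (Σ; _×_)
open import Data.Vec.Functional using ([]; _∷_)
open import Relation.Nullary using (¬_)
open import Algebra.Bundles using (CommutativeRing)

open import Level using (_⊔_)
open import Data.Nat as ℕ using (zero; suc; _<_; s≤s)
import Data.Nat.Properties as ℕ
open import Data.Integer as ℤ using (ℤ; +_; -[1+_]; _⊖_)
import Data.Integer.Properties as ℤ
open import Data.Fin using (zero; suc; punchIn; punchOut)
import Data.Fin.Properties as Fin
open import Data.Product using (proj₁; proj₂; _,_)
open import Data.Sum using (_⊎_; inj₁; inj₂)
open import Data.Empty using (⊥-elim)
open import Data.Maybe using (Maybe; just; nothing)
open import Data.Vec.Functional using (insertAt; removeAt)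
open import Data.Vec.Functional.Properties using (insertAt-lookup; insertAt-punchIn)
open import Relation.Nullary using (yes; no; ¬?)
open import Relation.Nullary.Decidable using (decidable-stable; map′)
open import Relation.Binary.Definitions using (Decidable)
open import Relation.Binary.PropositionalEquality as ≡ using (_≡_)
open import Algebra.Solver.Ring.AlmostCommutativeRing
  using (fromCommutativeRing; _-Raw-AlmostCommutative⟶_)

-- The ring solver has to decide equality of coefficients, which is impossible in an abstract ring,
-- so it is instantiated with integer coefficients mapped into R.
module IntegerRingSolver {c ℓ : Level} (R : CommutativeRing c ℓ) where

  open CommutativeRing R
  open import Algebra.Properties.Ring ring using (-‿involutive; -0#≈0#; -‿+-comm; -‿distribˡ-*; -‿distribʳ-*)
  open import Algebra.Properties.Semiring.Mult.TCOptimised semiring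
    using (1+×; ×-homo-+; ×1-homo-*) renaming (_×_ to _·_)
  open import Relation.Binary.Reasoning.Setoid setoid

  ⟦_⟧ℤ : ℤ → Carrier
  ⟦ + n      ⟧ℤ = n · 1#
  ⟦ -[1+ n ] ⟧ℤ = - (suc n · 1#)

  -‿homo : ∀ i → ⟦ ℤ.- i ⟧ℤ ≈ - ⟦ i ⟧ℤ
  -‿homo (+ zero)   = sym -0#≈0#
  -‿homo (+ suc n)  = refl
  -‿homo -[1+ n ]   = sym (-‿involutive _)

  ⊖-homo : ∀ m n → ⟦ m ⊖ n ⟧ℤ ≈ m · 1# - n · 1#
  ⊖-homo zero    zero    = sym (-‿inverseʳ 0#)
  ⊖-homo zero    (suc n) = sym (+-identityˡ _)
  ⊖-homo (suc m) zero    = sym (trans (+-congˡ -0#≈0#) (+-identityʳ _))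
  ⊖-homo (suc m) (suc n) = begin
    ⟦ suc m ⊖ suc n ⟧ℤ          ≡⟨ ≡.cong ⟦_⟧ℤ (ℤ.[1+m]⊖[1+n]≡m⊖n m n) ⟩
    ⟦ m ⊖ n ⟧ℤ                  ≈⟨ ⊖-homo m n ⟩
    a - b                       ≈⟨ +-congˡ (+-identityˡ (- b)) ⟨
    a + (0# + - b)              ≈⟨ +-congˡ (+-congʳ (-‿inverseʳ 1#)) ⟨
    a + ((1# - 1#) + - b)       ≈⟨ +-congˡ (+-assoc 1# (- 1#) (- b)) ⟩
    a + (1# + (- 1# + - b))     ≈⟨ +-congˡ (+-congˡ (-‿+-comm 1# b)) ⟩
    a + (1# + - (1# + b))       ≈⟨ +-assoc a 1# _ ⟨
    (a + 1#) - (1# + b)         ≈⟨ +-cong (trans (+-comm a 1#) (sym (1+× m 1#))) (-‿cong (sym (1+× n 1#))) ⟩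
    suc m · 1# - suc n · 1#     ∎
    where a = m · 1#
          b = n · 1#

  +-homo : ∀ i j → ⟦ i ℤ.+ j ⟧ℤ ≈ ⟦ i ⟧ℤ + ⟦ j ⟧ℤ
  +-homo (+ m)     (+ n)     = ×-homo-+ 1# m n
  +-homo (+ m)     -[1+ n ]  = ⊖-homo m (suc n)
  +-homo -[1+ m ]  (+ n)     = trans (⊖-homo n (suc m)) (+-comm _ _)
  +-homo -[1+ m ]  -[1+ n ]  = begin
    - (suc (suc (m ℕ.+ n)) · 1#)       ≡⟨ ≡.cong (λ k → - (suc k · 1#)) (ℕ.+-suc m n) ⟨
    - ((suc m ℕ.+ suc n) · 1#)         ≈⟨ -‿cong (×-homo-+ 1# (suc m) (suc n)) ⟩
    - (suc m · 1# + suc n · 1#)        ≈⟨ -‿+-comm _ _ ⟨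
    - (suc m · 1#) + - (suc n · 1#)    ∎

  *-homo⁺ : ∀ m j → ⟦ + m ℤ.* j ⟧ℤ ≈ m · 1# * ⟦ j ⟧ℤ
  *-homo⁺ m (+ n)     = trans (reflexive (≡.cong ⟦_⟧ℤ (≡.sym (ℤ.pos-* m n)))) (×1-homo-* m n)
  *-homo⁺ m -[1+ n ]  = begin
    ⟦ + m ℤ.* ℤ.- (+ suc n) ⟧ℤ         ≡⟨ ≡.cong ⟦_⟧ℤ (ℤ.neg-distribʳ-* (+ m) (+ suc n)) ⟨
    ⟦ ℤ.- (+ m ℤ.* + suc n) ⟧ℤ         ≈⟨ -‿homo (+ m ℤ.* + suc n) ⟩
    - ⟦ + m ℤ.* + suc n ⟧ℤ             ≈⟨ -‿cong (*-homo⁺ m (+ suc n)) ⟩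
    - (m · 1# * ⟦ + suc n ⟧ℤ)          ≈⟨ -‿distribʳ-* _ _ ⟩
    m · 1# * ⟦ -[1+ n ] ⟧ℤ             ∎

  *-homo : ∀ i j → ⟦ i ℤ.* j ⟧ℤ ≈ ⟦ i ⟧ℤ * ⟦ j ⟧ℤ
  *-homo (+ m)     j = *-homo⁺ m j
  *-homo -[1+ m ]  j = begin
    ⟦ ℤ.- (+ suc m) ℤ.* j ⟧ℤ           ≡⟨ ≡.cong ⟦_⟧ℤ (ℤ.neg-distribˡ-* (+ suc m) j) ⟨
    ⟦ ℤ.- (+ suc m ℤ.* j) ⟧ℤ           ≈⟨ -‿homo (+ suc m ℤ.* j) ⟩
    - ⟦ + suc m ℤ.* j ⟧ℤ               ≈⟨ -‿cong (*-homo⁺ (suc m) j) ⟩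
    - (suc m · 1# * ⟦ j ⟧ℤ)            ≈⟨ -‿distribˡ-* _ _ ⟩
    ⟦ -[1+ m ] ⟧ℤ * ⟦ j ⟧ℤ             ∎

  ℤ⟶R : ℤ.+-*-rawRing -Raw-AlmostCommutative⟶ fromCommutativeRing R
  ℤ⟶R = record
    { ⟦_⟧ = ⟦_⟧ℤ ; +-homo = +-homo ; *-homo = *-homo ; -‿homo = -‿homo
    ; 0-homo = refl ; 1-homo = refl }

  ≟-image : ∀ i j → Maybe (⟦ i ⟧ℤ ≈ ⟦ j ⟧ℤ)
  ≟-image i j with i ℤ.≟ j
  ... | yes ≡.refl = just refl
  ... | no  _      = nothing

  open import Algebra.Solver.Ring ℤ.+-*-rawRing (fromCommutativeRing R) ℤ⟶R ≟-image public

module LinearAlgebra {c ℓ : Level} (F : CommutativeRing c ℓ) (isField : IsFieldOn F)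
                     (_≟_ : Decidable (CommutativeRing._≈_ F)) where

  open CommutativeRing F hiding (zero)
  open IsFieldOn isField
  open PG4 F
  open import Algebra.Properties.Semiring.Sum semiring
    using (sum; sum-cong-≋; sum-remove; sum-replicate-zero; ∑-comm; ∑-distrib-+; *-distribˡ-sum; *-distribʳ-sum)
  open IntegerRingSolver F using (solve; _:=_; _:+_; _:*_; :-_; con)
  open import Data.Vec.Functional.Relation.Binary.Equality.Setoid setoid
    using (≋-refl; ≋-sym; ≋-trans)
  open import Relation.Binary.Reasoning.Setoid setoid

  1≉0 : ¬ 1# ≈ 0#
  1≉0 1≈0 = 0≉1 (sym 1≈0)

  inv : ∀ x → ¬ x ≈ 0# → Carrier
  inv x x≉0 = proj₁ (inverse x x≉0)

  inv-*-cancel : ∀ {x} (x≉0 : ¬ x ≈ 0#) y → inv x x≉0 * (x * y) ≈ y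
  inv-*-cancel {x} x≉0 y = begin
    inv x x≉0 * (x * y)  ≈⟨ sym (*-assoc _ x y) ⟩
    inv x x≉0 * x * y    ≈⟨ *-congʳ (trans (*-comm _ x) (proj₂ (inverse x x≉0))) ⟩
    1# * y               ≈⟨ *-identityˡ y ⟩
    y                    ∎

  +≈0⇒≈-1* : ∀ {x y} → x + y ≈ 0# → x ≈ - 1# * y
  +≈0⇒≈-1* {x} {y} x+y≈0 = begin
    x                       ≈⟨ solve 2 (λ x y → x := :- con (+ 1) :* y :+ (x :+ y)) refl x y ⟩
    - 1# * y + (x + y)      ≈⟨ +-congˡ x+y≈0 ⟩
    - 1# * y + 0#           ≈⟨ +-identityʳ _ ⟩
    - 1# * y                ∎

  nonzero-or-all-zero : ∀ {n} (f : Fin n → Carrier) → (Σ (Fin n) λ j → ¬ f j ≈ 0#) ⊎ (∀ j → f j ≈ 0#)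
  nonzero-or-all-zero f with Fin.any? (λ j → ¬? (f j ≟ 0#))
  ... | yes nonzero = inj₁ nonzero
  ... | no  none    = inj₂ λ j → decidable-stable (f j ≟ 0#) λ fj≉0 → none (j , fj≉0)

  Nontrivial : ∀ {n} → (Fin n → Carrier) → Set ℓ
  Nontrivial {n} cs = Σ (Fin n) λ i → ¬ cs i ≈ 0#

  -- The columns of M are the equations, so cs solves M when cs M = 0.
  Solves : ∀ {n k} → (Fin n → Fin k → Carrier) → (Fin n → Carrier) → Set ℓ
  Solves M cs = ∀ l → sum (λ j → cs j * M j l) ≈ 0#

  NontrivialSolution : ∀ {n k} → (Fin n → Fin k → Carrier) → Set (c ⊔ ℓ)
  NontrivialSolution M = Σ _ λ cs → Solves M cs × Nontrivial cs

  sum-insertAt : ∀ {n} (cs : Fin n → Carrier) p t (f : Fin (suc n) → Carrier) →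
                 sum (λ j → insertAt cs p t j * f j) ≈ t * f p + sum (λ j → cs j * f (punchIn p j))
  sum-insertAt cs p t f = begin
    sum (λ j → insertAt cs p t j * f j)
      ≈⟨ sum-remove {i = p} (λ j → insertAt cs p t j * f j) ⟩
    insertAt cs p t p * f p + sum (λ j → insertAt cs p t (punchIn p j) * f (punchIn p j))
      ≈⟨ +-cong (*-congʳ (reflexive (insertAt-lookup cs p t)))
                (sum-cong-≋ λ j → *-congʳ (reflexive (insertAt-punchIn cs p t j))) ⟩
    t * f p + sum (λ j → cs j * f (punchIn p j)) ∎

  solution-ignoring-zero-column : ∀ {n k} (M : Fin n → Fin (suc k) → Carrier) → (∀ j → M j zero ≈ 0#) →
                                  NontrivialSolution (λ j l → M j (suc l)) → NontrivialSolution M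
  solution-ignoring-zero-column {n} M column₀≈0 (cs , solves , nontrivial) = cs , solves′ , nontrivial
    where
    solves′ : Solves M cs
    solves′ zero    = begin
      sum (λ j → cs j * M j zero)  ≈⟨ sum-cong-≋ (λ j → trans (*-congˡ (column₀≈0 j)) (zeroʳ (cs j))) ⟩
      sum {n} (λ _ → 0#)           ≈⟨ sum-replicate-zero n ⟩
      0#                           ∎
    solves′ (suc l) = solves l

  -- Solve equation 0 for the unknown p and substitute the result into the other equations.
  eliminate : ∀ {n k} (M : Fin (suc n) → Fin (suc k) → Carrier) p → ¬ M p zero ≈ 0# → Fin n → Fin k → Carrier
  eliminate M p pivot≉0 j l = M (punchIn p j) (suc l) + - (M (punchIn p j) zero * inv (M p zero) pivot≉0 * M p (suc l))

  back-substitute : ∀ {n k} (M : Fin (suc n) → Fin (suc k) → Carrier) p (pivot≉0 : ¬ M p zero ≈ 0#) →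
                    NontrivialSolution (eliminate M p pivot≉0) → NontrivialSolution M
  back-substitute M p pivot≉0 (cs , solves , (i , csi≉0)) =
    insertAt cs p t , solves′ , punchIn p i , λ ≈0 → csi≉0 (trans (reflexive (≡.sym (insertAt-punchIn cs p t i))) ≈0)
    where
    ι : Carrier
    ι = inv (M p zero) pivot≉0
    S : Fin _ → Carrier
    S l = sum (λ j → cs j * M (punchIn p j) l)
    t : Carrier
    t = - (S zero * ι)
    solves′ : Solves M (insertAt cs p t)
    solves′ zero = begin
      sum (λ j → insertAt cs p t j * M j zero)  ≈⟨ sum-insertAt cs p t (λ j → M j zero) ⟩
      t * M p zero + S zero                     ≈⟨ solve 3 (λ s ι m → :- (s :* ι) :* m :+ s := s :+ :- (s :* (m :* ι)))
                                                            refl (S zero) ι (M p zero) ⟩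
      S zero + - (S zero * (M p zero * ι))      ≈⟨ +-congˡ (-‿cong (*-congˡ (proj₂ (inverse _ pivot≉0)))) ⟩
      S zero + - (S zero * 1#)                  ≈⟨ solve 1 (λ s → s :+ :- (s :* con (+ 1)) := con (+ 0)) refl (S zero) ⟩
      0#                                        ∎
    solves′ (suc l) = begin
      sum (λ j → insertAt cs p t j * M j (suc l))
        ≈⟨ sum-insertAt cs p t (λ j → M j (suc l)) ⟩
      t * q + S (suc l)
        ≈⟨ solve 4 (λ s ι q s′ → :- (s :* ι) :* q :+ s′ := s′ :+ s :* :- (ι :* q)) refl (S zero) ι q (S (suc l)) ⟩
      S (suc l) + S zero * - (ι * q)
        ≈⟨ +-congˡ (*-distribʳ-sum (- (ι * q)) (λ j → cs j * M (punchIn p j) zero)) ⟩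
      S (suc l) + sum (λ j → cs j * M (punchIn p j) zero * - (ι * q))
        ≈⟨ sym (∑-distrib-+ (λ j → cs j * M (punchIn p j) (suc l)) _) ⟩
      sum (λ j → cs j * M (punchIn p j) (suc l) + cs j * M (punchIn p j) zero * - (ι * q))
        ≈⟨ sum-cong-≋ (λ j → solve 5 (λ c a b ι q → c :* a :+ c :* b :* :- (ι :* q) := c :* (a :+ :- (b :* ι :* q)))
                                     refl (cs j) (M (punchIn p j) (suc l)) (M (punchIn p j) zero) ι q) ⟩
      sum (λ j → cs j * eliminate M p pivot≉0 j l)
        ≈⟨ solves l ⟩
      0# ∎
      where q = M p (suc l)

  homogeneous-solvable : ∀ k {n} → k < n → (M : Fin n → Fin k → Carrier) → NontrivialSolution M
  homogeneous-solvable ℕ.zero {suc n} _ M = (λ _ → 1#) , (λ ()) , zero , 1≉0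
  homogeneous-solvable (suc k) {suc n} (s≤s k<n) M with nonzero-or-all-zero (λ j → M j zero)
  ... | inj₂ column₀≈0      = solution-ignoring-zero-column M column₀≈0
                                (homogeneous-solvable k (ℕ.m<n⇒m<1+n k<n) (λ j l → M j (suc l)))
  ... | inj₁ (p , pivot≉0) = back-substitute M p pivot≉0 (homogeneous-solvable k k<n (eliminate M p pivot≉0))

  lincomb-sum : ∀ {k} (cs : Fin k → Carrier) (g : Fin k → V) i → lincomb cs g i ≈ sum (λ j → cs j * g j i)
  lincomb-sum {ℕ.zero} cs g i = refl
  lincomb-sum {suc k}  cs g i = +-congˡ (lincomb-sum (λ j → cs (suc j)) (λ j → g (suc j)) i)

  lincomb-removeAt : ∀ {k} (cs : Fin (suc k) → Carrier) (g : Fin (suc k) → V) p →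
                     lincomb cs g ≈ᵥ ((cs p • g p) +ᵥ lincomb (removeAt cs p) (removeAt g p))
  lincomb-removeAt cs g p i = begin
    lincomb cs g i                                         ≈⟨ lincomb-sum cs g i ⟩
    sum (λ j → cs j * g j i)                               ≈⟨ sum-remove {i = p} (λ j → cs j * g j i) ⟩
    cs p * g p i + sum (removeAt (λ j → cs j * g j i) p)   ≈⟨ +-congˡ (lincomb-sum (removeAt cs p) (removeAt g p) i) ⟨
    cs p * g p i + lincomb (removeAt cs p) (removeAt g p) i ∎

  lincomb-removeAt-≈0 : ∀ {k} (cs : Fin (suc k) → Carrier) (g : Fin (suc k) → V) p → cs p ≈ 0# →
                        lincomb cs g ≈ᵥ lincomb (removeAt cs p) (removeAt g p)
  lincomb-removeAt-≈0 cs g p csp≈0 i = begin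
    lincomb cs g i                                           ≈⟨ lincomb-removeAt cs g p i ⟩
    cs p * g p i + lincomb (removeAt cs p) (removeAt g p) i  ≈⟨ +-congʳ (trans (*-congʳ csp≈0) (zeroˡ _)) ⟩
    0# + lincomb (removeAt cs p) (removeAt g p) i            ≈⟨ +-identityˡ _ ⟩
    lincomb (removeAt cs p) (removeAt g p) i                 ∎

  lincomb-0 : ∀ {k} (g : Fin k → V) → lincomb (λ _ → 0#) g ≈ᵥ 0ᵥ
  lincomb-0 {ℕ.zero} g i = refl
  lincomb-0 {suc k}  g i = trans (+-cong (zeroˡ _) (lincomb-0 (λ j → g (suc j)) i)) (+-identityʳ 0#)

  lincomb-+ : ∀ {k} (cs ds : Fin k → Carrier) (g : Fin k → V) →
              lincomb (λ j → cs j + ds j) g ≈ᵥ (lincomb cs g +ᵥ lincomb ds g)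
  lincomb-+ {ℕ.zero} cs ds g i = sym (+-identityʳ 0#)
  lincomb-+ {suc k}  cs ds g i =
    trans (+-congˡ (lincomb-+ (λ j → cs (suc j)) (λ j → ds (suc j)) (λ j → g (suc j)) i))
          (solve 5 (λ a b x r s → (a :+ b) :* x :+ (r :+ s) := (a :* x :+ r) :+ (b :* x :+ s))
                 refl (cs zero) (ds zero) (g zero i) _ _)

  lincomb-• : ∀ {k} a (cs : Fin k → Carrier) (g : Fin k → V) → lincomb (λ j → a * cs j) g ≈ᵥ (a • lincomb cs g)
  lincomb-• {ℕ.zero} a cs g i = sym (zeroʳ a)
  lincomb-• {suc k}  a cs g i =
    trans (+-congˡ (lincomb-• a (λ j → cs (suc j)) (λ j → g (suc j)) i))
          (trans (+-congʳ (*-assoc a (cs zero) (g zero i))) (sym (distribˡ a _ _)))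

  record Subspace (T : PSet) : Set (c ⊔ ℓ) where
    field
      ∈-resp-≈ᵥ : ∀ {u v} → u ≈ᵥ v → T u → T v
      0ᵥ∈      : T 0ᵥ
      +ᵥ-closed : ∀ {u v} → T u → T v → T (u +ᵥ v)
      •-closed  : ∀ a {u} → T u → T (a • u)

  open Subspace public

  span-subspace : ∀ {k} (g : Fin k → V) → Subspace ⟦ g ⟧
  span-subspace g = record
    { ∈-resp-≈ᵥ = λ { u≈v (cs , u≈) → cs , ≋-trans (≋-sym u≈v) u≈ }
    ; 0ᵥ∈      = (λ _ → 0#) , ≋-sym (lincomb-0 g)
    ; +ᵥ-closed = λ { (cs , u≈) (ds , v≈) →
                      (λ j → cs j + ds j) , λ i → trans (+-cong (u≈ i) (v≈ i)) (sym (lincomb-+ cs ds g i)) }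
    ; •-closed  = λ { a (cs , u≈) → (λ j → a * cs j) , λ i → trans (*-congˡ (u≈ i)) (sym (lincomb-• a cs g i)) }
    }

  ∩-subspace : ∀ {S T} → Subspace S → Subspace T → Subspace (S ∩ T)
  ∩-subspace S T = record
    { ∈-resp-≈ᵥ = λ { u≈v (u∈S , u∈T) → ∈-resp-≈ᵥ S u≈v u∈S , ∈-resp-≈ᵥ T u≈v u∈T }
    ; 0ᵥ∈      = 0ᵥ∈ S , 0ᵥ∈ T
    ; +ᵥ-closed = λ { (u∈S , u∈T) (v∈S , v∈T) → +ᵥ-closed S u∈S v∈S , +ᵥ-closed T u∈T v∈T }
    ; •-closed  = λ { a (u∈S , u∈T) → •-closed S a u∈S , •-closed T a u∈T }
    }

  lincomb-closed : ∀ {T} → Subspace T → ∀ {k} cs (g : Fin k → V) → (∀ j → T (g j)) → T (lincomb cs g)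
  lincomb-closed T {ℕ.zero} cs g g∈T = 0ᵥ∈ T
  lincomb-closed T {suc k}  cs g g∈T =
    +ᵥ-closed T (•-closed T (cs zero) (g∈T zero))
                (lincomb-closed T (λ j → cs (suc j)) (λ j → g (suc j)) (λ j → g∈T (suc j)))

  span-⊆ : ∀ {T} → Subspace T → ∀ {k} (g : Fin k → V) → (∀ j → T (g j)) → ⟦ g ⟧ ⊆ T
  span-⊆ T g g∈T v (cs , v≈) = ∈-resp-≈ᵥ T (≋-sym v≈) (lincomb-closed T cs g g∈T)

  span-mono : ∀ {k m} (g : Fin k → V) (h : Fin m → V) → (∀ j → ⟦ h ⟧ (g j)) → ⟦ g ⟧ ⊆ ⟦ h ⟧
  span-mono g h = span-⊆ (span-subspace h) g

  δ : ∀ {k} → Fin k → Fin k → Carrier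
  δ zero    zero    = 1#
  δ zero    (suc _) = 0#
  δ (suc _) zero    = 0#
  δ (suc i) (suc j) = δ i j

  ∑-δ : ∀ {k} (f : Fin k → Carrier) j → sum (λ i → δ j i * f i) ≈ f j
  ∑-δ {suc k} f zero    = begin
    1# * f zero + sum (λ i → 0# * f (suc i))   ≈⟨ +-cong (*-identityˡ _) (sum-cong-≋ λ i → zeroˡ (f (suc i))) ⟩
    f zero + sum {k} (λ _ → 0#)                ≈⟨ +-congˡ (sum-replicate-zero k) ⟩
    f zero + 0#                                ≈⟨ +-identityʳ _ ⟩
    f zero                                     ∎
  ∑-δ {suc k} f (suc j) = trans (+-cong (zeroˡ _) (∑-δ (λ i → f (suc i)) j)) (+-identityˡ _)

  ∈-span : ∀ {k} (g : Fin k → V) j → ⟦ g ⟧ (g j)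
  ∈-span g j = δ j , λ i → sym (trans (lincomb-sum (δ j) g i) (∑-δ (λ l → g l i) j))

  standard-basis : Fin 5 → V
  standard-basis j i = δ i j

  ∈-standard-span : ∀ v → ⟦ standard-basis ⟧ v
  ∈-standard-span v = v , λ i → sym (begin
    lincomb v standard-basis i    ≈⟨ lincomb-sum v standard-basis i ⟩
    sum (λ j → v j * δ i j)       ≈⟨ sum-cong-≋ (λ j → *-comm (v j) (δ i j)) ⟩
    sum (λ j → δ i j * v j)       ≈⟨ ∑-δ v i ⟩
    v i                           ∎)

  •-cancel : ∀ {T} → Subspace T → ∀ {a w} → ¬ a ≈ 0# → T (a • w) → T w
  •-cancel T {a} a≉0 aw∈T = ∈-resp-≈ᵥ T (λ i → inv-*-cancel a≉0 _) (•-closed T (inv a a≉0) aw∈T)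

  relation-isolate : ∀ {T} → Subspace T → ∀ {k} (cs : Fin (suc k) → Carrier) g → lincomb cs g ≈ᵥ 0ᵥ →
                     ∀ p → (∀ j → T (removeAt g p j)) → T (cs p • g p)
  relation-isolate T cs g relation p others∈T =
    ∈-resp-≈ᵥ T (λ i → sym (+≈0⇒≈-1* (trans (sym (lincomb-removeAt cs g p i)) (relation i))))
               (•-closed T (- 1#) (lincomb-closed T (removeAt cs p) (removeAt g p) others∈T))

  relation-solve : ∀ {T} → Subspace T → ∀ {k} (cs : Fin (suc k) → Carrier) g → lincomb cs g ≈ᵥ 0ᵥ →
                   ∀ p → (∀ j → T (removeAt g p j)) → ¬ cs p ≈ 0# → T (g p)
  relation-solve T cs g relation p others∈T csp≉0 = •-cancel T csp≉0 (relation-isolate T cs g relation p others∈T)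

  relation-coefficient≈0 : ∀ {T} → Subspace T → ∀ {k} (cs : Fin (suc k) → Carrier) g → lincomb cs g ≈ᵥ 0ᵥ →
                           ∀ p → (∀ j → T (removeAt g p j)) → ¬ T (g p) → cs p ≈ 0#
  relation-coefficient≈0 T cs g relation p others∈T gp∉T with cs p ≟ 0#
  ... | yes csp≈0 = csp≈0
  ... | no  csp≉0 = ⊥-elim (gp∉T (relation-solve T cs g relation p others∈T csp≉0))

  ∈span⇒relation : ∀ {k v} {g : Fin k → V} ((cs , _) : ⟦ g ⟧ v) → lincomb (- 1# ∷ cs) (v ∷ g) ≈ᵥ 0ᵥ
  ∈span⇒relation {v = v} {g} (cs , v≈) i = begin
    - 1# * v i + lincomb cs g i              ≈⟨ +-congʳ (*-congˡ (v≈ i)) ⟩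
    - 1# * lincomb cs g i + lincomb cs g i   ≈⟨ solve 1 (λ x → :- con (+ 1) :* x :+ x := con (+ 0)) refl _ ⟩
    0#                                       ∎

  generator-∈ : ∀ {T} → Subspace T → ∀ {k v} (g : Fin (suc k) → V) p (v∈ : ⟦ g ⟧ v) → T v →
                (∀ j → T (removeAt g p j)) → ¬ proj₁ v∈ p ≈ 0# → T (g p)
  generator-∈ T {v = v} g p v∈@(cs , _) v∈T others∈T =
    relation-solve T (- 1# ∷ cs) (v ∷ g) (∈span⇒relation {g = g} v∈) (suc p)
                   λ { zero → v∈T ; (suc j) → others∈T j }

  coefficient≈0 : ∀ {T} → Subspace T → ∀ {k v} (g : Fin (suc k) → V) p (v∈ : ⟦ g ⟧ v) → T v →
                  (∀ j → T (removeAt g p j)) → ¬ T (g p) → proj₁ v∈ p ≈ 0#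
  coefficient≈0 T {v = v} g p v∈@(cs , _) v∈T others∈T =
    relation-coefficient≈0 T (- 1# ∷ cs) (v ∷ g) (∈span⇒relation {g = g} v∈) (suc p)
                           λ { zero → v∈T ; (suc j) → others∈T j }

  SamePoint⇒∈span : ∀ {u v} → SamePoint v u → ⟦ u ∷ [] ⟧ v
  SamePoint⇒∈span (a , v≈) = (λ _ → a) , λ i → trans (v≈ i) (sym (+-identityʳ _))

  ∈span⇒SamePoint : ∀ {u v} → ⟦ u ∷ [] ⟧ v → SamePoint v u
  ∈span⇒SamePoint (cs , v≈) = cs zero , λ i → trans (v≈ i) (+-identityʳ _)

  ∈span-zero-coefficient : ∀ {k v} (g : Fin (suc k) → V) p (v∈ : ⟦ g ⟧ v) → proj₁ v∈ p ≈ 0# → ⟦ removeAt g p ⟧ v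
  ∈span-zero-coefficient g p (cs , v≈) csp≈0 = removeAt cs p , ≋-trans v≈ (lincomb-removeAt-≈0 cs g p csp≈0)

  ∈span-removeAt : ∀ {T} → Subspace T → ∀ {k v} (g : Fin (suc k) → V) p → ⟦ g ⟧ v → T v →
                   (∀ j → T (removeAt g p j)) → ¬ T (g p) → ⟦ removeAt g p ⟧ v
  ∈span-removeAt T g p v∈ v∈T others∈T gp∉T =
    ∈span-zero-coefficient g p v∈ (coefficient≈0 T g p v∈ v∈T others∈T gp∉T)

  nonzero-multiple-∈ : ∀ {T} → Subspace T → ∀ {u v} → ⟦ u ∷ [] ⟧ v → NonZero v → T v → T u
  nonzero-multiple-∈ T {u} v∈@(cs , _) v≉0 v∈T with cs zero ≟ 0#
  ... | yes a≈0 = ⊥-elim (v≉0 (proj₂ (∈span-zero-coefficient (u ∷ []) zero v∈ a≈0)))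
  ... | no  a≉0 = generator-∈ T (u ∷ []) zero v∈ v∈T (λ ()) a≉0

  pair-coefficient≉0 : ∀ {T} → Subspace T → ∀ {v} (g : Fin 2 → V) p (v∈ : ⟦ g ⟧ v) →
                       NonZero v → T v → ¬ T (removeAt g p zero) → ¬ proj₁ v∈ p ≈ 0#
  pair-coefficient≉0 T g p v∈ v≉0 v∈T other∉T csp≈0 =
    other∉T (nonzero-multiple-∈ T (∈span-zero-coefficient g p v∈ csp≈0) v≉0 v∈T)

  Dependent : ∀ {n} → (Fin n → V) → Set (c ⊔ ℓ)
  Dependent w = Σ _ λ cs → lincomb cs w ≈ᵥ 0ᵥ × Nontrivial cs

  dependent-of-span : ∀ {k n} (g : Fin k → V) (w : Fin n → V) → k < n → (∀ j → ⟦ g ⟧ (w j)) → Dependent w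
  dependent-of-span {k} g w k<n w∈ with homogeneous-solvable k k<n (λ j → proj₁ (w∈ j))
  ... | cs , solves , nontrivial = cs , relation , nontrivial
    where
    M : Fin _ → Fin k → Carrier
    M j = proj₁ (w∈ j)
    relation : lincomb cs w ≈ᵥ 0ᵥ
    relation x = begin
      lincomb cs w x
        ≈⟨ lincomb-sum cs w x ⟩
      sum (λ j → cs j * w j x)
        ≈⟨ sum-cong-≋ (λ j → *-congˡ (trans (proj₂ (w∈ j) x) (lincomb-sum (M j) g x))) ⟩
      sum (λ j → cs j * sum (λ l → M j l * g l x))
        ≈⟨ sum-cong-≋ (λ j → trans (*-distribˡ-sum (cs j) (λ l → M j l * g l x))
                                   (sum-cong-≋ λ l → sym (*-assoc (cs j) (M j l) (g l x)))) ⟩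
      sum (λ j → sum (λ l → cs j * M j l * g l x))
        ≈⟨ ∑-comm (λ j l → cs j * M j l * g l x) ⟩
      sum (λ l → sum (λ j → cs j * M j l * g l x))
        ≈⟨ sum-cong-≋ (λ l → sym (*-distribʳ-sum (g l x) (λ j → cs j * M j l))) ⟩
      sum (λ l → sum (λ j → cs j * M j l) * g l x)
        ≈⟨ sum-cong-≋ (λ l → trans (*-congʳ (solves l)) (zeroˡ _)) ⟩
      sum {k} (λ _ → 0#)
        ≈⟨ sum-replicate-zero k ⟩
      0# ∎

  relation-tail : ∀ {k} (cs : Fin (suc k) → Carrier) w → cs zero ≈ 0# → lincomb cs w ≈ᵥ 0ᵥ →
                  lincomb (λ j → cs (suc j)) (λ j → w (suc j)) ≈ᵥ 0ᵥ
  relation-tail cs w cs₀≈0 relation = ≋-trans (≋-sym (lincomb-removeAt-≈0 cs w zero cs₀≈0)) relation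

  dependent-removeAt : ∀ {T} → Subspace T → ∀ {k} (g : Fin (suc k) → V) p → Dependent g →
                       (∀ j → T (removeAt g p j)) → ¬ T (g p) → Dependent (removeAt g p)
  dependent-removeAt T g p (cs , relation , i , csi≉0) others∈T gp∉T =
    removeAt cs p , ≋-trans (≋-sym (lincomb-removeAt-≈0 cs g p csp≈0)) relation , nontrivial
    where
    csp≈0 : cs p ≈ 0#
    csp≈0 = relation-coefficient≈0 T cs g relation p others∈T gp∉T
    nontrivial : Nontrivial (removeAt cs p)
    nontrivial with p Fin.≟ i
    ... | yes ≡.refl = ⊥-elim (csi≉0 csp≈0)
    ... | no  p≢i    = punchOut p≢i , λ ≈0 → csi≉0 (trans (reflexive (≡.cong cs (≡.sym (Fin.punchIn-punchOut p≢i)))) ≈0)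

  ∷-relation-trivial : ∀ {k} w (g : Fin k → V) → Independent g → ∀ cs → cs zero ≈ 0# →
                       lincomb cs (w ∷ g) ≈ᵥ 0ᵥ → ∀ i → cs i ≈ 0#
  ∷-relation-trivial w g g-ind cs cs₀≈0 relation zero    = cs₀≈0
  ∷-relation-trivial w g g-ind cs cs₀≈0 relation (suc j) =
    g-ind (λ j → cs (suc j)) (relation-tail cs (w ∷ g) cs₀≈0 relation) j

  dependent-∷⇒∈span : ∀ {k} v (g : Fin k → V) → Dependent (v ∷ g) → Independent g → ⟦ g ⟧ v
  dependent-∷⇒∈span v g (cs , relation , i , csi≉0) g-ind with cs zero ≟ 0#
  ... | no  cs₀≉0 = relation-solve (span-subspace g) cs (v ∷ g) relation zero (∈-span g) cs₀≉0
  ... | yes cs₀≈0 = ⊥-elim (csi≉0 (∷-relation-trivial v g g-ind cs cs₀≈0 relation i))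

  ∷-independent : ∀ {T} → Subspace T → ∀ {k} w (g : Fin k → V) → Independent g → ¬ T w → (∀ j → T (g j)) →
                  Independent (w ∷ g)
  ∷-independent T w g g-ind w∉T g∈T cs relation =
    ∷-relation-trivial w g g-ind cs (relation-coefficient≈0 T cs (w ∷ g) relation zero g∈T w∉T) relation

  single-independent : ∀ {v} → NonZero v → Independent (v ∷ [])
  single-independent {v} v≉0 = ∷-independent (span-subspace []) v [] (λ _ _ ()) (λ v∈ → v≉0 (proj₂ v∈)) (λ ())

  independent⇒lincomb-nonzero : ∀ {k} (g : Fin k → V) {cs} → Independent g → Nontrivial cs → NonZero (lincomb cs g)
  independent⇒lincomb-nonzero g {cs} g-ind (i , csi≉0) ≈0 = csi≉0 (g-ind cs ≈0 i)

  independent-spans : ∀ {k} (α b : Fin k → V) → Independent b → (∀ j → ⟦ α ⟧ (b j)) → ⟦ α ⟧ ⊆ ⟦ b ⟧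
  independent-spans {k} α b b-ind b∈α v v∈α =
    dependent-∷⇒∈span v b (dependent-of-span α (v ∷ b) (ℕ.n<1+n k) λ { zero → v∈α ; (suc j) → b∈α j }) b-ind

  line-∩-unique : ∀ {T} → Subspace T → (ℓ : Fin 2 → V) → ¬ T (ℓ zero) → ∀ {u w} →
                  ⟦ ℓ ⟧ u → T u → ⟦ ℓ ⟧ w → T w → NonZero w → ⟦ w ∷ [] ⟧ u
  line-∩-unique T ℓ ℓ₀∉T {u} {w} u∈ℓ u∈T w∈ℓ w∈T w≉0 =
    dependent-∷⇒∈span u (w ∷ [])
      (dependent-removeAt T (ℓ zero ∷ u ∷ w ∷ []) zero
        (dependent-of-span ℓ (ℓ zero ∷ u ∷ w ∷ []) ℕ.≤-refl
           λ { zero → ∈-span ℓ zero ; (suc zero) → u∈ℓ ; (suc (suc zero)) → w∈ℓ })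
        (λ { zero → u∈T ; (suc zero) → w∈T }) ℓ₀∉T)
      (single-independent w≉0)

  record LineMeets (l : Fin 2 → V) (T : PSet) : Set (c ⊔ ℓ) where
    field
      coefficients : Fin 2 → Carrier
      nontrivial   : Nontrivial coefficients
      point∈       : T (lincomb coefficients l)

    point : V
    point = lincomb coefficients l

    point∈line : ⟦ l ⟧ point
    point∈line = coefficients , ≋-refl

    point-nonzero : Independent l → NonZero point
    point-nonzero l-ind = independent⇒lincomb-nonzero l l-ind nontrivial

  line-meets-hyperplane : ∀ {k} (g : Fin (suc k) → V) (σ : Fin k → V) → Independent σ → ∀ {u w} →
                          ⟦ g ⟧ u → ⟦ g ⟧ w → (∀ j → ⟦ g ⟧ (σ j)) → LineMeets (u ∷ w ∷ []) ⟦ σ ⟧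
  line-meets-hyperplane g σ σ-ind {u} {w} u∈g w∈g σ∈g
    with dependent-of-span g (u ∷ w ∷ σ) ℕ.≤-refl (λ { zero → u∈g ; (suc zero) → w∈g ; (suc (suc j)) → σ∈g j })
  ... | cs , relation , i , csi≉0 = record { coefficients = x ∷ y ∷ [] ; nontrivial = nontrivial ; point∈ = W∈σ }
    where
    x y : Carrier
    x = cs zero
    y = cs (suc zero)
    W : V
    W = lincomb (x ∷ y ∷ []) (u ∷ w ∷ [])
    W-relation : lincomb (1# ∷ λ j → cs (suc (suc j))) (W ∷ σ) ≈ᵥ 0ᵥ
    W-relation i = trans (solve 3 (λ a b r → con (+ 1) :* (a :+ (b :+ con (+ 0))) :+ r := a :+ (b :+ r))
                                  refl (x * u i) (y * w i) _)
                         (relation i)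
    W∈σ : ⟦ σ ⟧ W
    W∈σ = relation-solve (span-subspace σ) (1# ∷ λ j → cs (suc (suc j))) (W ∷ σ) W-relation zero (∈-span σ) 1≉0
    nontrivial : Nontrivial (x ∷ y ∷ [])
    nontrivial with x ≟ 0# | y ≟ 0#
    ... | no x≉0 | _      = zero , x≉0
    ... | yes _  | no y≉0 = suc zero , y≉0
    ... | yes x≈0 | yes y≈0 = ⊥-elim (csi≉0 (all-zero i))
      where
      all-zero : ∀ i → cs i ≈ 0#
      all-zero zero    = x≈0
      all-zero (suc j) =
        ∷-relation-trivial w σ σ-ind (λ j → cs (suc j)) y≈0 (relation-tail cs (u ∷ w ∷ σ) x≈0 relation) j

module Geometry {c ℓ : Level} (F : CommutativeRing c ℓ) (isField : IsFieldOn F)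
                (_≟_ : Decidable (CommutativeRing._≈_ F)) (C : PG4.Configuration F) where

  open CommutativeRing F hiding (zero)
  open PG4 F
  open Configuration C
  open LinearAlgebra F isField _≟_
  open import Data.Vec.Functional.Relation.Binary.Equality.Setoid setoid using (≋-refl)

  ≐∩⇒⊆ˡ : ∀ {S T U : PSet} → S ≐ (T ∩ U) → S ⊆ T
  ≐∩⇒⊆ˡ S≐ v v∈S = proj₁ (proj₁ S≐ v v∈S)

  ≐∩⇒⊆ʳ : ∀ {S T U : PSet} → S ≐ (T ∩ U) → S ⊆ U
  ≐∩⇒⊆ʳ S≐ v v∈S = proj₂ (proj₁ S≐ v v∈S)

  ≐∩⇒⊇ : ∀ {S T U : PSet} → S ≐ (T ∩ U) → ∀ {v} → T v → U v → S v
  ≐∩⇒⊇ S≐ v∈T v∈U = proj₂ S≐ _ (v∈T , v∈U)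

  ≐∩-comm : ∀ {S T U : PSet} → S ≐ (T ∩ U) → S ≐ (U ∩ T)
  ≐∩-comm S≐ = (λ v v∈S → ≐∩⇒⊆ʳ S≐ v v∈S , ≐∩⇒⊆ˡ S≐ v v∈S) , (λ v (v∈U , v∈T) → ≐∩⇒⊇ S≐ v∈T v∈U)

  m⊆Σ₃ : ⟦ m ⟧ ⊆ ⟦ Σ₃ ⟧
  m⊆Σ₃ v v∈m = proj₂ (≐∩⇒⊆ʳ m-def v v∈m)

  m⊆π₁₂ : ⟦ m ⟧ ⊆ ⟦ π₁₂ ⟧
  m⊆π₁₂ v v∈m = ≐∩⇒⊇ π₁₂-def (≐∩⇒⊆ˡ m-def v v∈m) (proj₁ (≐∩⇒⊆ʳ m-def v v∈m))

  π₁₂∩Σ₃⊆m : ∀ {v} → ⟦ π₁₂ ⟧ v → ⟦ Σ₃ ⟧ v → ⟦ m ⟧ v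
  π₁₂∩Σ₃⊆m v∈π₁₂ v∈Σ₃ = ≐∩⇒⊇ m-def (≐∩⇒⊆ˡ π₁₂-def _ v∈π₁₂) (≐∩⇒⊆ʳ π₁₂-def _ v∈π₁₂ , v∈Σ₃)

  m⊆Σ₁ : ⟦ m ⟧ ⊆ ⟦ Σ₁ ⟧
  m⊆Σ₁ = ≐∩⇒⊆ˡ m-def

  m⊆Σ₂ : ⟦ m ⟧ ⊆ ⟦ Σ₂ ⟧
  m⊆Σ₂ v v∈m = proj₁ (≐∩⇒⊆ʳ m-def v v∈m)

  line⊈π⇒∉ : ∀ {S T : PSet} (π : Fin 3 → V) {M N} → ⟦ π ⟧ ≐ (S ∩ T) → ⟦ π ⟧ M → S N →
             ¬ (⟦ M ∷ N ∷ [] ⟧ ⊆ ⟦ π ⟧) → ¬ T N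
  line⊈π⇒∉ π {M} {N} π≐ M∈π N∈S line⊈π N∈T =
    line⊈π (span-⊆ (span-subspace π) (M ∷ N ∷ []) λ { zero → M∈π ; (suc zero) → ≐∩⇒⊇ π≐ N∈S N∈T })

  P₁₃∈Σ₁ : ⟦ Σ₁ ⟧ P₁₃
  P₁₃∈Σ₁ = ≐∩⇒⊆ˡ π₁₃-def _ P₁₃∈π₁₃

  P₁₃∈Σ₃ : ⟦ Σ₃ ⟧ P₁₃
  P₁₃∈Σ₃ = ≐∩⇒⊆ʳ π₁₃-def _ P₁₃∈π₁₃

  P₂₃∈Σ₂ : ⟦ Σ₂ ⟧ P₂₃
  P₂₃∈Σ₂ = ≐∩⇒⊆ˡ π₂₃-def _ P₂₃∈π₂₃

  P₂₃∈Σ₃ : ⟦ Σ₃ ⟧ P₂₃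
  P₂₃∈Σ₃ = ≐∩⇒⊆ʳ π₂₃-def _ P₂₃∈π₂₃

  P₁₃∉Σ₂ : ¬ ⟦ Σ₂ ⟧ P₁₃
  P₁₃∉Σ₂ P₁₃∈Σ₂ = P₁₃∉m (≐∩⇒⊇ m-def P₁₃∈Σ₁ (P₁₃∈Σ₂ , P₁₃∈Σ₃))

  P₂₃∉Σ₁ : ¬ ⟦ Σ₁ ⟧ P₂₃
  P₂₃∉Σ₁ P₂₃∈Σ₁ = P₂₃∉m (≐∩⇒⊇ m-def P₂₃∈Σ₁ (P₂₃∈Σ₂ , P₂₃∈Σ₃))

  N₁∉Σ₂ : ¬ ⟦ Σ₂ ⟧ N₁
  N₁∉Σ₂ = line⊈π⇒∉ π₁₂ π₁₂-def (m⊆π₁₂ _ M₁∈m) N₁∈Σ₁ ℓ₁₁⊈π₁₂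

  N₁∉Σ₃ : ¬ ⟦ Σ₃ ⟧ N₁
  N₁∉Σ₃ = line⊈π⇒∉ π₁₃ π₁₃-def (≐∩⇒⊇ π₁₃-def (m⊆Σ₁ _ M₁∈m) (m⊆Σ₃ _ M₁∈m)) N₁∈Σ₁ ℓ₁₁⊈π₁₃

  N₂∉Σ₁ : ¬ ⟦ Σ₁ ⟧ N₂
  N₂∉Σ₁ = line⊈π⇒∉ π₁₂ (≐∩-comm π₁₂-def) (m⊆π₁₂ _ M₂∈m) N₂∈Σ₂ ℓ₂₁⊈π₁₂

  N₂∉Σ₃ : ¬ ⟦ Σ₃ ⟧ N₂
  N₂∉Σ₃ = line⊈π⇒∉ π₂₃ π₂₃-def (≐∩⇒⊇ π₂₃-def (m⊆Σ₂ _ M₂∈m) (m⊆Σ₃ _ M₂∈m)) N₂∈Σ₂ ℓ₂₁⊈π₂₃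

  module Line𝔞 (R : V) (𝔞-ind : Independent (P₁₂ ∷ R ∷ [])) (R∈π₁₂ : ⟦ π₁₂ ⟧ R)
               (𝔞≠⟨M₁,P₁₂⟩ : ¬ (⟦ P₁₂ ∷ R ∷ [] ⟧ ≐ ⟦ M₁ ∷ P₁₂ ∷ [] ⟧))
               (𝔞≠⟨M₂,P₁₂⟩ : ¬ (⟦ P₁₂ ∷ R ∷ [] ⟧ ≐ ⟦ M₂ ∷ P₁₂ ∷ [] ⟧)) where

    𝔞 : Fin 2 → V
    𝔞 = P₁₂ ∷ R ∷ []

    𝔞⊆π₁₂ : ⟦ 𝔞 ⟧ ⊆ ⟦ π₁₂ ⟧
    𝔞⊆π₁₂ = span-mono 𝔞 π₁₂ λ { zero → P₁₂∈π₁₂ ; (suc zero) → R∈π₁₂ }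

    module Side (Σᵢ Σⱼ : Fin 4 → V) (Σⱼ-ind : Independent Σⱼ) (π₁₂≐ : ⟦ π₁₂ ⟧ ≐ (⟦ Σᵢ ⟧ ∩ ⟦ Σⱼ ⟧))
                (Mᵢ Nᵢ Pᵢ₃ : V) (Mᵢ-nz : NonZero Mᵢ) (Mᵢ∈m : ⟦ m ⟧ Mᵢ) (ℓᵢ₁-ind : Independent (Mᵢ ∷ Nᵢ ∷ []))
                (Nᵢ∈Σᵢ : ⟦ Σᵢ ⟧ Nᵢ) (Nᵢ∉Σⱼ : ¬ ⟦ Σⱼ ⟧ Nᵢ) (Nᵢ∉Σ₃ : ¬ ⟦ Σ₃ ⟧ Nᵢ)
                (Pᵢ₃∈Σᵢ : ⟦ Σᵢ ⟧ Pᵢ₃) (Pᵢ₃∉Σⱼ : ¬ ⟦ Σⱼ ⟧ Pᵢ₃)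
                (ℓᵢ₁∩ℓᵢ₂ : ¬ Meets ⟦ Mᵢ ∷ Nᵢ ∷ [] ⟧ ⟦ P₁₂ ∷ Pᵢ₃ ∷ [] ⟧)
                (𝔞≠⟨Mᵢ,P₁₂⟩ : ¬ (⟦ 𝔞 ⟧ ≐ ⟦ Mᵢ ∷ P₁₂ ∷ [] ⟧)) where

      ℓᵢ₁ ℓᵢ₂ : Fin 2 → V
      ℓᵢ₁ = Mᵢ ∷ Nᵢ ∷ []
      ℓᵢ₂ = P₁₂ ∷ Pᵢ₃ ∷ []

      σ : Fin 3 → V
      σ = Pᵢ₃ ∷ P₁₂ ∷ R ∷ []

      π₁₂⊆Σᵢ : ⟦ π₁₂ ⟧ ⊆ ⟦ Σᵢ ⟧
      π₁₂⊆Σᵢ = ≐∩⇒⊆ˡ π₁₂≐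

      π₁₂⊆Σⱼ : ⟦ π₁₂ ⟧ ⊆ ⟦ Σⱼ ⟧
      π₁₂⊆Σⱼ = ≐∩⇒⊆ʳ π₁₂≐

      𝔞⊆Σⱼ : ∀ j → ⟦ Σⱼ ⟧ (𝔞 j)
      𝔞⊆Σⱼ j = π₁₂⊆Σⱼ _ (𝔞⊆π₁₂ _ (∈-span 𝔞 j))

      Mᵢ∈Σᵢ : ⟦ Σᵢ ⟧ Mᵢ
      Mᵢ∈Σᵢ = π₁₂⊆Σᵢ _ (m⊆π₁₂ _ Mᵢ∈m)

      ℓᵢ₁⊆Σᵢ : ⟦ ℓᵢ₁ ⟧ ⊆ ⟦ Σᵢ ⟧
      ℓᵢ₁⊆Σᵢ = span-⊆ (span-subspace Σᵢ) ℓᵢ₁ λ { zero → Mᵢ∈Σᵢ ; (suc zero) → Nᵢ∈Σᵢ }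

      ℓᵢ₂⊆Σᵢ : ⟦ ℓᵢ₂ ⟧ ⊆ ⟦ Σᵢ ⟧
      ℓᵢ₂⊆Σᵢ = span-⊆ (span-subspace Σᵢ) ℓᵢ₂ λ { zero → π₁₂⊆Σᵢ _ P₁₂∈π₁₂ ; (suc zero) → Pᵢ₃∈Σᵢ }

      ℓᵢ₂⊆σ : ⟦ ℓᵢ₂ ⟧ ⊆ ⟦ σ ⟧
      ℓᵢ₂⊆σ = span-mono ℓᵢ₂ σ λ { zero → ∈-span σ (suc zero) ; (suc zero) → ∈-span σ zero }

      𝔞⊆σ : ⟦ 𝔞 ⟧ ⊆ ⟦ σ ⟧
      𝔞⊆σ = span-mono 𝔞 σ λ j → ∈-span σ (suc j)

      σ-ind : Independent σ
      σ-ind = ∷-independent (span-subspace Σⱼ) Pᵢ₃ 𝔞 𝔞-ind Pᵢ₃∉Σⱼ 𝔞⊆Σⱼ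

      Mᵢ∉σ : ¬ ⟦ σ ⟧ Mᵢ
      Mᵢ∉σ Mᵢ∈σ = 𝔞≠⟨Mᵢ,P₁₂⟩ (𝔞⊆⟨Mᵢ,P₁₂⟩ , span-mono (Mᵢ ∷ P₁₂ ∷ []) 𝔞 λ { zero → Mᵢ∈𝔞 ; (suc zero) → ∈-span 𝔞 zero })
        where
        Mᵢ∈𝔞 : ⟦ 𝔞 ⟧ Mᵢ
        Mᵢ∈𝔞 = ∈span-removeAt (span-subspace Σⱼ) σ zero Mᵢ∈σ (π₁₂⊆Σⱼ _ (m⊆π₁₂ _ Mᵢ∈m)) 𝔞⊆Σⱼ Pᵢ₃∉Σⱼ
        P₁₂Mᵢ-ind : Independent (P₁₂ ∷ Mᵢ ∷ [])
        P₁₂Mᵢ-ind = ∷-independent (span-subspace m) P₁₂ (Mᵢ ∷ []) (single-independent Mᵢ-nz) P₁₂∉m λ { zero → Mᵢ∈m }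
        𝔞⊆⟨Mᵢ,P₁₂⟩ : ⟦ 𝔞 ⟧ ⊆ ⟦ Mᵢ ∷ P₁₂ ∷ [] ⟧
        𝔞⊆⟨Mᵢ,P₁₂⟩ v v∈𝔞 =
          span-mono (P₁₂ ∷ Mᵢ ∷ []) (Mᵢ ∷ P₁₂ ∷ [])
                    (λ { zero → ∈-span (Mᵢ ∷ P₁₂ ∷ []) (suc zero) ; (suc zero) → ∈-span (Mᵢ ∷ P₁₂ ∷ []) zero }) v
            (independent-spans 𝔞 (P₁₂ ∷ Mᵢ ∷ []) P₁₂Mᵢ-ind (λ { zero → ∈-span 𝔞 zero ; (suc zero) → Mᵢ∈𝔞 }) v v∈𝔞)

      E-meeting : LineMeets ℓᵢ₁ ⟦ σ ⟧
      E-meeting = line-meets-hyperplane Σᵢ σ σ-ind Mᵢ∈Σᵢ Nᵢ∈Σᵢ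
                    λ { zero → Pᵢ₃∈Σᵢ ; (suc j) → π₁₂⊆Σᵢ _ (𝔞⊆π₁₂ _ (∈-span 𝔞 j)) }

      open LineMeets E-meeting public using () renaming (point to E; point∈line to E∈ℓᵢ₁; point∈ to E∈σ)

      E-nz : NonZero E
      E-nz = LineMeets.point-nonzero E-meeting ℓᵢ₁-ind

      E∈Σᵢ : ⟦ Σᵢ ⟧ E
      E∈Σᵢ = ℓᵢ₁⊆Σᵢ E E∈ℓᵢ₁

      E∉ : ∀ {T} → Subspace T → T Mᵢ → ¬ T Nᵢ → ¬ T E
      E∉ T Mᵢ∈T Nᵢ∉T E∈T = Nᵢ∉T (generator-∈ T ℓᵢ₁ (suc zero) E∈ℓᵢ₁ E∈T (λ { zero → Mᵢ∈T }) Nᵢ-coefficient≉0)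
        where
        Nᵢ-coefficient≉0 : ¬ proj₁ E∈ℓᵢ₁ (suc zero) ≈ 0#
        Nᵢ-coefficient≉0 = pair-coefficient≉0 (span-subspace σ) ℓᵢ₁ (suc zero) E∈ℓᵢ₁ E-nz E∈σ Mᵢ∉σ

      E∉Σⱼ : ¬ ⟦ Σⱼ ⟧ E
      E∉Σⱼ = E∉ (span-subspace Σⱼ) (π₁₂⊆Σⱼ _ (m⊆π₁₂ _ Mᵢ∈m)) Nᵢ∉Σⱼ

      E∉Σ₃ : ¬ ⟦ Σ₃ ⟧ E
      E∉Σ₃ = E∉ (span-subspace Σ₃) (m⊆Σ₃ _ Mᵢ∈m) Nᵢ∉Σ₃

      transversal-∈σ : ∀ {A} {α : Fin 3 → V} → ⟦ 𝔞 ⟧ A → ¬ SamePoint A P₁₂ → MeetsPreciselyIn α ⟦ π₁₂ ⟧ A →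
                       Meets ⟦ α ⟧ ⟦ ℓᵢ₂ ⟧ → ∀ {C′} → NonZero C′ → ⟦ α ⟧ C′ → ⟦ ℓᵢ₁ ⟧ C′ → ⟦ σ ⟧ C′
      transversal-∈σ {A} {α} A∈𝔞 A≁P₁₂ (_ , _ , α∩π₁₂⊆A) (B , B-nz , B∈α , B∈ℓᵢ₂) {C′} C′-nz C′∈α C′∈ℓᵢ₁ =
        generator-∈ (span-subspace σ) (C′ ∷ B ∷ []) zero W∈ W∈σ (λ { zero → ℓᵢ₂⊆σ B B∈ℓᵢ₂ }) C′-coefficient≉0
        where
        B∉Σⱼ : ¬ ⟦ Σⱼ ⟧ B
        B∉Σⱼ B∈Σⱼ =
          A≁P₁₂ (∈span⇒SamePoint (nonzero-multiple-∈ (span-subspace (P₁₂ ∷ [])) (SamePoint⇒∈span B~A) B-nz B∈⟨P₁₂⟩))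
          where
          B∈⟨P₁₂⟩ : ⟦ P₁₂ ∷ [] ⟧ B
          B∈⟨P₁₂⟩ = ∈span-removeAt (span-subspace Σⱼ) ℓᵢ₂ (suc zero) B∈ℓᵢ₂ B∈Σⱼ (λ { zero → π₁₂⊆Σⱼ _ P₁₂∈π₁₂ }) Pᵢ₃∉Σⱼ
          B~A : SamePoint B A
          B~A = α∩π₁₂⊆A B B-nz B∈α (span-mono (P₁₂ ∷ []) π₁₂ (λ { zero → P₁₂∈π₁₂ }) B B∈⟨P₁₂⟩)
        W-meeting : LineMeets (C′ ∷ B ∷ []) ⟦ Σⱼ ⟧
        W-meeting = line-meets-hyperplane standard-basis Σⱼ Σⱼ-ind (∈-standard-span C′) (∈-standard-span B)
                                          (λ j → ∈-standard-span (Σⱼ j))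
        open LineMeets W-meeting using () renaming (point to W; point∈line to W∈; point∈ to W∈Σⱼ)
        W-nz : NonZero W
        W-nz W≈0 = ℓᵢ₁∩ℓᵢ₂ (C′ , C′-nz , C′∈ℓᵢ₁ , span-mono (B ∷ []) ℓᵢ₂ (λ { zero → B∈ℓᵢ₂ }) C′ C′∈⟨B⟩)
          where
          C′∈⟨B⟩ : ⟦ B ∷ [] ⟧ C′
          C′∈⟨B⟩ = dependent-∷⇒∈span C′ (B ∷ []) (proj₁ W∈ , W≈0 , LineMeets.nontrivial W-meeting)
                                     (single-independent B-nz)
        W∈π₁₂ : ⟦ π₁₂ ⟧ W
        W∈π₁₂ = ≐∩⇒⊇ π₁₂≐ (span-⊆ (span-subspace Σᵢ) (C′ ∷ B ∷ [])
                                  (λ { zero → ℓᵢ₁⊆Σᵢ C′ C′∈ℓᵢ₁ ; (suc zero) → ℓᵢ₂⊆Σᵢ B B∈ℓᵢ₂ }) W W∈)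
                          W∈Σⱼ
        W∈α : ⟦ α ⟧ W
        W∈α = span-mono (C′ ∷ B ∷ []) α (λ { zero → C′∈α ; (suc zero) → B∈α }) W W∈
        W∈σ : ⟦ σ ⟧ W
        W∈σ = span-mono (A ∷ []) σ (λ { zero → 𝔞⊆σ A A∈𝔞 }) W (SamePoint⇒∈span (α∩π₁₂⊆A W W-nz W∈α W∈π₁₂))
        C′-coefficient≉0 : ¬ proj₁ W∈ zero ≈ 0#
        C′-coefficient≉0 = pair-coefficient≉0 (span-subspace Σⱼ) (C′ ∷ B ∷ []) zero W∈ W-nz W∈Σⱼ B∉Σⱼ

      E∈α : ∀ {A} {α : Fin 3 → V} → ⟦ 𝔞 ⟧ A → ¬ SamePoint A P₁₂ → MeetsPreciselyIn α ⟦ π₁₂ ⟧ A →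
            Meets ⟦ α ⟧ ⟦ ℓᵢ₂ ⟧ → Meets ⟦ α ⟧ ⟦ ℓᵢ₁ ⟧ → ⟦ α ⟧ E
      E∈α {A} {α} A∈𝔞 A≁P₁₂ precise meets-ℓᵢ₂ (C′ , C′-nz , C′∈α , C′∈ℓᵢ₁) =
        span-mono (C′ ∷ []) α (λ { zero → C′∈α }) E
          (line-∩-unique (span-subspace σ) ℓᵢ₁ Mᵢ∉σ E∈ℓᵢ₁ E∈σ C′∈ℓᵢ₁
             (transversal-∈σ {A} {α} A∈𝔞 A≁P₁₂ precise meets-ℓᵢ₂ C′-nz C′∈α C′∈ℓᵢ₁) C′-nz)

    module S₁ = Side Σ₁ Σ₂ Σ₂-ind π₁₂-def M₁ N₁ P₁₃ M₁-nz M₁∈m ℓ₁₁-ind N₁∈Σ₁ N₁∉Σ₂ N₁∉Σ₃ P₁₃∈Σ₁ P₁₃∉Σ₂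
                     ℓ₁₁∩ℓ₁₂ 𝔞≠⟨M₁,P₁₂⟩
    module S₂ = Side Σ₂ Σ₁ Σ₁-ind (≐∩-comm π₁₂-def) M₂ N₂ P₂₃ M₂-nz M₂∈m ℓ₂₁-ind N₂∈Σ₂ N₂∉Σ₁ N₂∉Σ₃ P₂₃∈Σ₂ P₂₃∉Σ₁
                     ℓ₂₁∩ℓ₂₂ 𝔞≠⟨M₂,P₁₂⟩

    open S₁ using () renaming (E to E₁; E∈Σᵢ to E₁∈Σ₁; E∉Σⱼ to E₁∉Σ₂; E∉Σ₃ to E₁∉Σ₃)
    open S₂ using () renaming (E to E₂; E∉Σⱼ to E₂∉Σ₁)

    Q-meeting : LineMeets 𝔞 ⟦ m ⟧
    Q-meeting = line-meets-hyperplane π₁₂ m m-ind P₁₂∈π₁₂ R∈π₁₂ λ j → m⊆π₁₂ _ (∈-span m j)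

    open LineMeets Q-meeting using () renaming (point to Q; point∈line to Q∈𝔞; point∈ to Q∈m)

    Q-nz : NonZero Q
    Q-nz = LineMeets.point-nonzero Q-meeting 𝔞-ind

    𝔞∩m⊆⟨Q⟩ : ∀ {u} → ⟦ 𝔞 ⟧ u → ⟦ m ⟧ u → ⟦ Q ∷ [] ⟧ u
    𝔞∩m⊆⟨Q⟩ u∈𝔞 u∈m = line-∩-unique (span-subspace m) 𝔞 P₁₂∉m u∈𝔞 u∈m Q∈𝔞 Q∈m Q-nz

    τ : Fin 3 → V
    τ = P₂₃ ∷ P₁₃ ∷ Q ∷ []

    τ-ind : Independent τ
    τ-ind = ∷-independent (span-subspace Σ₁) P₂₃ (P₁₃ ∷ Q ∷ [])
              (∷-independent (span-subspace Σ₂) P₁₃ (Q ∷ []) (single-independent Q-nz) P₁₃∉Σ₂ λ { zero → m⊆Σ₂ _ Q∈m })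
              P₂₃∉Σ₁ λ { zero → P₁₃∈Σ₁ ; (suc zero) → m⊆Σ₁ _ Q∈m }

    τ⊆Σ₃ : ⟦ τ ⟧ ⊆ ⟦ Σ₃ ⟧
    τ⊆Σ₃ = span-⊆ (span-subspace Σ₃) τ λ { zero → P₂₃∈Σ₃ ; (suc zero) → P₁₃∈Σ₃ ; (suc (suc zero)) → m⊆Σ₃ _ Q∈m }

    s⊆τ : ⟦ s ⟧ ⊆ ⟦ τ ⟧
    s⊆τ = span-mono s τ λ { zero → ∈-span τ (suc zero) ; (suc zero) → ∈-span τ zero }

    H : Fin 4 → V
    H = P₂₃ ∷ P₁₃ ∷ P₁₂ ∷ R ∷ []

    H∩Σ₃⊆τ : ∀ {v} → ⟦ H ⟧ v → ⟦ Σ₃ ⟧ v → ⟦ τ ⟧ v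
    H∩Σ₃⊆τ {v} (h , v≈) v∈Σ₃ =
      span-⊆ (span-subspace τ) (P₂₃ ∷ P₁₃ ∷ u ∷ [])
             (λ { zero → ∈-span τ zero ; (suc zero) → ∈-span τ (suc zero) ; (suc (suc zero)) → u∈τ }) v v∈
      where
      u : V
      u = lincomb (h (suc (suc zero)) ∷ h (suc (suc (suc zero))) ∷ []) 𝔞
      u∈𝔞 : ⟦ 𝔞 ⟧ u
      u∈𝔞 = (h (suc (suc zero)) ∷ h (suc (suc (suc zero))) ∷ []) , ≋-refl
      v∈ : ⟦ P₂₃ ∷ P₁₃ ∷ u ∷ [] ⟧ v
      v∈ = (h zero ∷ h (suc zero) ∷ 1# ∷ []) ,
           λ i → trans (v≈ i) (+-congˡ (+-congˡ (sym (trans (+-identityʳ _) (*-identityˡ (u i))))))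
      u∈Σ₃ : ⟦ Σ₃ ⟧ u
      u∈Σ₃ = generator-∈ (span-subspace Σ₃) (P₂₃ ∷ P₁₃ ∷ u ∷ []) (suc (suc zero)) v∈ v∈Σ₃
                         (λ { zero → P₂₃∈Σ₃ ; (suc zero) → P₁₃∈Σ₃ }) 1≉0
      u∈τ : ⟦ τ ⟧ u
      u∈τ = span-mono (Q ∷ []) τ (λ { zero → ∈-span τ (suc (suc zero)) }) u
              (𝔞∩m⊆⟨Q⟩ u∈𝔞 (π₁₂∩Σ₃⊆m (𝔞⊆π₁₂ u u∈𝔞) u∈Σ₃))

    E₂E₁-ind : Independent (E₂ ∷ E₁ ∷ [])
    E₂E₁-ind = ∷-independent (span-subspace Σ₁) E₂ (E₁ ∷ []) (single-independent S₁.E-nz) E₂∉Σ₁ λ { zero → E₁∈Σ₁ }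

    X-meeting : LineMeets (E₂ ∷ E₁ ∷ []) ⟦ Σ₃ ⟧
    X-meeting = line-meets-hyperplane standard-basis Σ₃ Σ₃-ind (∈-standard-span E₂) (∈-standard-span E₁)
                                      λ j → ∈-standard-span (Σ₃ j)

    open LineMeets X-meeting public using () renaming (point to X; point∈line to X∈; point∈ to X∈Σ₃)

    X-nz : NonZero X
    X-nz = LineMeets.point-nonzero X-meeting E₂E₁-ind

    X∉Σ₁ : ¬ ⟦ Σ₁ ⟧ X
    X∉Σ₁ X∈Σ₁ = E₂∉Σ₁ (generator-∈ (span-subspace Σ₁) (E₂ ∷ E₁ ∷ []) zero X∈ X∈Σ₁ (λ { zero → E₁∈Σ₁ })
                        (pair-coefficient≉0 (span-subspace Σ₃) (E₂ ∷ E₁ ∷ []) zero X∈ X-nz X∈Σ₃ E₁∉Σ₃))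

    X∈β : β X
    X∈β = span-mono (E₂ ∷ E₁ ∷ []) ℓ₁₁ℓ₂₁
            (λ { zero → span-mono ℓ₂₁ ℓ₁₁ℓ₂₁ (λ j → ∈-span ℓ₁₁ℓ₂₁ (suc (suc j))) E₂ S₂.E∈ℓᵢ₁
               ; (suc zero) → span-mono ℓ₁₁ ℓ₁₁ℓ₂₁ (λ { zero → ∈-span ℓ₁₁ℓ₂₁ zero ; (suc zero) → ∈-span ℓ₁₁ℓ₂₁ (suc zero) })
                                  E₁ S₁.E∈ℓᵢ₁ })
            X X∈
          , X∈Σ₃
      where
      ℓ₁₁ℓ₂₁ : Fin 4 → V
      ℓ₁₁ℓ₂₁ = M₁ ∷ N₁ ∷ M₂ ∷ N₂ ∷ []

    E₁∈H : ⟦ H ⟧ E₁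
    E₁∈H = span-mono S₁.σ H (λ { zero → ∈-span H (suc zero) ; (suc j) → ∈-span H (suc (suc j)) }) E₁ S₁.E∈σ

    E₂∈H : ⟦ H ⟧ E₂
    E₂∈H = span-mono S₂.σ H (λ { zero → ∈-span H zero ; (suc j) → ∈-span H (suc (suc j)) }) E₂ S₂.E∈σ

    module PlaneαOf {A : V} {α : Fin 3 → V} (A-nz : NonZero A) (A∈𝔞 : ⟦ 𝔞 ⟧ A) (A≁P₁₂ : ¬ SamePoint A P₁₂)
                 (α-def : IsαOf A α) where

      meets-ℓ₁₁ : Meets ⟦ α ⟧ ⟦ ℓ₁₁ ⟧
      meets-ℓ₁₁ = proj₁ (proj₂ (proj₁ α-def))

      meets-ℓ₁₂ : Meets ⟦ α ⟧ ⟦ ℓ₁₂ ⟧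
      meets-ℓ₁₂ = proj₁ (proj₂ (proj₂ (proj₁ α-def)))

      meets-ℓ₂₁ : Meets ⟦ α ⟧ ⟦ ℓ₂₁ ⟧
      meets-ℓ₂₁ = proj₁ (proj₂ (proj₂ (proj₂ (proj₁ α-def))))

      meets-ℓ₂₂ : Meets ⟦ α ⟧ ⟦ ℓ₂₂ ⟧
      meets-ℓ₂₂ = proj₂ (proj₂ (proj₂ (proj₂ (proj₁ α-def))))

      precise : MeetsPreciselyIn α ⟦ π₁₂ ⟧ A
      precise = proj₂ α-def

      A∈α : ⟦ α ⟧ A
      A∈α = proj₁ precise

      A∈Σ₁ : ⟦ Σ₁ ⟧ A
      A∈Σ₁ = ≐∩⇒⊆ˡ π₁₂-def A (𝔞⊆π₁₂ A A∈𝔞)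

      A∈Σ₂ : ⟦ Σ₂ ⟧ A
      A∈Σ₂ = ≐∩⇒⊆ʳ π₁₂-def A (𝔞⊆π₁₂ A A∈𝔞)

      E₁∈α : ⟦ α ⟧ E₁
      E₁∈α = S₁.E∈α {A} {α} A∈𝔞 A≁P₁₂ precise meets-ℓ₁₂ meets-ℓ₁₁

      E₂∈α : ⟦ α ⟧ E₂
      E₂∈α = S₂.E∈α {A} {α} A∈𝔞 A≁P₁₂ precise meets-ℓ₂₂ meets-ℓ₂₁

      E₁A-ind : Independent (E₁ ∷ A ∷ [])
      E₁A-ind = ∷-independent (span-subspace Σ₂) E₁ (A ∷ []) (single-independent A-nz) E₁∉Σ₂ λ { zero → A∈Σ₂ }

      b : Fin 3 → V
      b = E₂ ∷ E₁ ∷ A ∷ []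

      α⊆b : ⟦ α ⟧ ⊆ ⟦ b ⟧
      α⊆b = independent-spans α b
              (∷-independent (span-subspace Σ₁) E₂ (E₁ ∷ A ∷ []) E₁A-ind E₂∉Σ₁ λ { zero → E₁∈Σ₁ ; (suc zero) → A∈Σ₁ })
              λ { zero → E₂∈α ; (suc zero) → E₁∈α ; (suc (suc zero)) → A∈α }

      D-meeting : LineMeets (E₁ ∷ A ∷ []) ⟦ Σ₃ ⟧
      D-meeting = line-meets-hyperplane standard-basis Σ₃ Σ₃-ind (∈-standard-span E₁) (∈-standard-span A)
                                        λ j → ∈-standard-span (Σ₃ j)

      open LineMeets D-meeting public using () renaming (point to D; point∈line to D∈; point∈ to D∈Σ₃)

      D-nz : NonZero D
      D-nz = LineMeets.point-nonzero D-meeting E₁A-ind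

      A-coefficient≉0 : ¬ proj₁ D∈ (suc zero) ≈ 0#
      A-coefficient≉0 = pair-coefficient≉0 (span-subspace Σ₃) (E₁ ∷ A ∷ []) (suc zero) D∈ D-nz D∈Σ₃ E₁∉Σ₃

      D∈Σ₁ : ⟦ Σ₁ ⟧ D
      D∈Σ₁ = span-⊆ (span-subspace Σ₁) (E₁ ∷ A ∷ []) (λ { zero → E₁∈Σ₁ ; (suc zero) → A∈Σ₁ }) D D∈

      D∈α : ⟦ α ⟧ D
      D∈α = span-mono (E₁ ∷ A ∷ []) α (λ { zero → E₁∈α ; (suc zero) → A∈α }) D D∈

      X∈α : ⟦ α ⟧ X
      X∈α = span-mono (E₂ ∷ E₁ ∷ []) α (λ { zero → E₂∈α ; (suc zero) → E₁∈α }) X X∈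

      XD-ind : Independent (X ∷ D ∷ [])
      XD-ind = ∷-independent (span-subspace Σ₁) X (D ∷ []) (single-independent D-nz) X∉Σ₁ λ { zero → D∈Σ₁ }

      a₃⊆⟨X,D⟩ : a₃ α ⊆ ⟦ X ∷ D ∷ [] ⟧
      a₃⊆⟨X,D⟩ v (v∈α , v∈Σ₃) =
        dependent-∷⇒∈span v (X ∷ D ∷ [])
          (dependent-removeAt (span-subspace Σ₃) (E₁ ∷ v ∷ X ∷ D ∷ []) zero
             (dependent-of-span b (E₁ ∷ v ∷ X ∷ D ∷ []) ℕ.≤-refl
                λ { zero → ∈-span b (suc zero) ; (suc zero) → α⊆b v v∈α
                  ; (suc (suc zero)) → α⊆b X X∈α ; (suc (suc (suc zero))) → α⊆b D D∈α })
             (λ { zero → v∈Σ₃ ; (suc zero) → X∈Σ₃ ; (suc (suc zero)) → D∈Σ₃ }) E₁∉Σ₃)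
          XD-ind

      a₃-isLine : IsLine (a₃ α)
      a₃-isLine = X , D , XD-ind , a₃⊆⟨X,D⟩ ,
                  span-⊆ (∩-subspace (span-subspace α) (span-subspace Σ₃)) (X ∷ D ∷ [])
                         λ { zero → X∈α , X∈Σ₃ ; (suc zero) → D∈α , D∈Σ₃ }

      a₃⊆τ : a₃ α ⊆ ⟦ τ ⟧
      a₃⊆τ v (v∈α , v∈Σ₃) =
        H∩Σ₃⊆τ (span-mono b H (λ { zero → E₂∈H ; (suc zero) → E₁∈H ; (suc (suc zero)) → A∈H }) v (α⊆b v v∈α)) v∈Σ₃
        where
        A∈H : ⟦ H ⟧ A
        A∈H = span-mono 𝔞 H (λ j → ∈-span H (suc (suc j))) A A∈𝔞

      X∈a₃ : a₃ α X
      X∈a₃ = X∈α , X∈Σ₃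

    a₃-injective : ∀ {A A′} {α α′ : Fin 3 → V} → NonZero A → NonZero A′ → ⟦ 𝔞 ⟧ A → ⟦ 𝔞 ⟧ A′ →
                   ¬ SamePoint A P₁₂ → ¬ SamePoint A′ P₁₂ → IsαOf A α → IsαOf A′ α′ →
                   a₃ α ≐ a₃ α′ → SamePoint A A′
    a₃-injective {A} {A′} {α} {α′} A-nz A′-nz A∈𝔞 A′∈𝔞 A≁P₁₂ A′≁P₁₂ α-def α′-def a₃≐ =
      ∈span⇒SamePoint
        (∈span-removeAt (span-subspace Σ₂) (E₁ ∷ A′ ∷ []) zero A∈⟨E₁,A′⟩ P.A∈Σ₂ (λ { zero → P′.A∈Σ₂ }) E₁∉Σ₂)
      where
      module P  = PlaneαOf {A} {α} A-nz A∈𝔞 A≁P₁₂ α-def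
      module P′ = PlaneαOf {A′} {α′} A′-nz A′∈𝔞 A′≁P₁₂ α′-def
      D∈⟨E₁,A′⟩ : ⟦ E₁ ∷ A′ ∷ [] ⟧ P.D
      D∈⟨E₁,A′⟩ = ∈span-removeAt (span-subspace Σ₁) P′.b zero (P′.α⊆b P.D (proj₁ (proj₁ a₃≐ P.D (P.D∈α , P.D∈Σ₃))))
                                 P.D∈Σ₁ (λ { zero → E₁∈Σ₁ ; (suc zero) → P′.A∈Σ₁ }) E₂∉Σ₁
      A∈⟨E₁,A′⟩ : ⟦ E₁ ∷ A′ ∷ [] ⟧ A
      A∈⟨E₁,A′⟩ = generator-∈ (span-subspace (E₁ ∷ A′ ∷ [])) (E₁ ∷ A ∷ []) (suc zero) P.D∈ D∈⟨E₁,A′⟩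
                              (λ { zero → ∈-span (E₁ ∷ A′ ∷ []) zero }) P.A-coefficient≉0

finite⇒≈-decidable : ∀ {c ℓ : Level} {F : CommutativeRing c ℓ} {q : ℕ} → IsFiniteFieldOfOrder F q →
                     Decidable (CommutativeRing._≈_ F)
finite⇒≈-decidable {F = F} FF x y = map′ index≡⇒≈ ≈⇒index≡ (index x Fin.≟ index y)
  where
  open CommutativeRing F
  open IsFiniteFieldOfOrder FF
  index : Carrier → Fin _
  index z = proj₁ (enum-surj z)
  index≡⇒≈ : index x ≡ index y → x ≈ y
  index≡⇒≈ i≡j = trans (sym (proj₂ (enum-surj x))) (trans (reflexive (≡.cong enum i≡j)) (proj₂ (enum-surj y)))
  ≈⇒index≡ : x ≈ y → index x ≡ index y
  ≈⇒index≡ x≈y = enum-inj _ _ (trans (proj₂ (enum-surj x)) (trans x≈y (sym (proj₂ (enum-surj y)))))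

mainTheorem20 :
    ∀ {c ℓ : Level} (F : CommutativeRing c ℓ) (q : ℕ) → IsFiniteFieldOfOrder F q →
    let open PG4 F in
    (C : Configuration) →
    let open Configuration C in
    (R : V) → Independent (P₁₂ ∷ R ∷ []) → ⟦ π₁₂ ⟧ R →
    ¬ (⟦ P₁₂ ∷ R ∷ [] ⟧ ≐ ⟦ M₁ ∷ P₁₂ ∷ [] ⟧) →
    ¬ (⟦ P₁₂ ∷ R ∷ [] ⟧ ≐ ⟦ M₂ ∷ P₁₂ ∷ [] ⟧) →
    Σ (Fin 3 → V) λ τ → Independent τ × (⟦ τ ⟧ ⊆ ⟦ Σ₃ ⟧) × (⟦ s ⟧ ⊆ ⟦ τ ⟧) ×
    Σ V λ X → NonZero X × β X ×
    (∀ A α → NonZero A → ⟦ P₁₂ ∷ R ∷ [] ⟧ A → ¬ SamePoint A P₁₂ → IsαOf A α →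
       IsLine (a₃ α) × (a₃ α ⊆ ⟦ τ ⟧) × a₃ α X) ×
    (∀ A A' α α' → NonZero A → NonZero A' →
       ⟦ P₁₂ ∷ R ∷ [] ⟧ A → ⟦ P₁₂ ∷ R ∷ [] ⟧ A' →
       ¬ SamePoint A P₁₂ → ¬ SamePoint A' P₁₂ → ¬ SamePoint A A' →
       IsαOf A α → IsαOf A' α' → ¬ (a₃ α ≐ a₃ α'))
mainTheorem20 F q FF C R 𝔞-ind R∈π₁₂ 𝔞≠⟨M₁,P₁₂⟩ 𝔞≠⟨M₂,P₁₂⟩ =
  τ , τ-ind , τ⊆Σ₃ , s⊆τ , X , X-nz , X∈β ,
  (λ A α A-nz A∈𝔞 A≁P₁₂ α-def → let open PlaneαOf {A} {α} A-nz A∈𝔞 A≁P₁₂ α-def in a₃-isLine , a₃⊆τ , X∈a₃) ,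
  λ A A′ α α′ A-nz A′-nz A∈𝔞 A′∈𝔞 A≁P₁₂ A′≁P₁₂ A≁A′ α-def α′-def a₃≐ →
    A≁A′ (a₃-injective {A} {A′} {α} {α′} A-nz A′-nz A∈𝔞 A′∈𝔞 A≁P₁₂ A′≁P₁₂ α-def α′-def a₃≐)
  where
  open Geometry F (IsFiniteFieldOfOrder.isField FF) (finite⇒≈-decidable FF) C
  open Line𝔞 R 𝔞-ind R∈π₁₂ 𝔞≠⟨M₁,P₁₂⟩ 𝔞≠⟨M₂,P₁₂⟩
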